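{- Let $n>1$ and $k>0$ be integers, and let $a$ be an integer with $0<a<n^k$ and $\gcd(a,n)=1$. Let $a_0 = a \bmod n$ (the least significant radix-$n$ digit of $a$), and let $c\in\{0,1,\dots,n-1\}$ be the integer with $ca\equiv 1 \pmod n$. Define integers $T_0,\dots,T_{k-1}$ and digits $X_0,\dots,X_{k-1}$ by $$T_0=\frac{ca_0-1}{n},\qquad X_0=c,$$ and for $i=1,\dots,k-1$, $$T_i=\left\lfloor \frac{T_{i-1}+X_{i-1}a}{n}\right\rfloor,\qquad X_i = (-cT_i) \bmod n \in\{0,1,\dots,n-1\}.$$ Then $x=\sum_{i=0}^{k-1} X_i n^i$ satisfies $0\le x<n^k$ and $ax\equiv 1 \pmod{n^k}$, i.e. $x=a^{ -1} \bmod n^k$.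
   Context: This is the correctness of the paper's algorithm for inversion modulo $n^k$ for general $n>1$. Here $y \bmod n$ denotes the least nonnegative residue of $y$ modulo $n$. Note that $ca_0\equiv 1\pmod n$, so $T_0$ is an integer. -}

module Defs where

open import Data.Nat as ℕ using (ℕ; zero; suc; NonZero; _^_)
open import Data.Nat.DivMod using (_%_)
open import Data.Integer as ℤ using (ℤ; +_; -_; 1ℤ)
open import Data.Integer.DivMod using (_/ℕ_; _%ℕ_)

module InvAlg (n : ℕ) .{{_ : NonZero n}} (a c : ℕ) where

  a₀ : ℕ
  a₀ = a % n

  -- T i and X i; integer division _/ℕ_ on ℤ is floor division
  -- (a ≡ a %ℕ n + (a /ℕ n) * n with 0 ≤ a %ℕ n < n), and _%ℕ_ is the least
  -- nonnegative residue.
  T : ℕ → ℤ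
  X : ℕ → ℕ

  T zero    = (+ (c ℕ.* a₀) ℤ.- 1ℤ) /ℕ n
  T (suc i) = (T i ℤ.+ + (X i ℕ.* a)) /ℕ n

  X zero    = c
  X (suc i) = (- (+ c ℤ.* T (suc i))) %ℕ n

  x : ℕ → ℕ
  x zero    = 0
  x (suc k) = x k ℕ.+ X k ℕ.* n ^ k

-- For i ≥ 1 the algorithm maintains the invariant  n^i T_i = a x_i − 1.
-- It starts at i = 1 because T₀ + c a = (T₀ + 1) + q n with ca = 1 + q n and
-- 0 ≤ T₀ + 1 < n, so T₁ = q.  It is preserved because X_i ≡ −c T_i makes
-- T_i + X_i a ≡ T_i − T_i c a ≡ 0 (mod n), so the floor in T_{i+1} is an
-- exact division and n^{i+1} T_{i+1} = n^i (T_i + X_i a) = a x_{i+1} − 1.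
module Submission where

open import Defs
open import Data.Nat using (ℕ; NonZero; _<_; _*_; _^_)
open import Data.Nat.DivMod using (_%_)
open import Data.Nat.GCD using (gcd)
open import Data.Integer using (+_; _-_; 1ℤ)
open import Data.Integer.Divisibility using (_∣_)
open import Data.Product using (_×_)
open import Relation.Binary.PropositionalEquality using (_≡_)

open import Data.Nat using (zero; suc; s≤s; z≤n; s≤s⁻¹; _+_)
open import Data.Nat.DivMod using (_/_)
import Data.Nat.Properties as ℕ
import Data.Nat.DivMod as ℕ
import Data.Nat.Divisibility as ℕ
open import Data.Integer.Base as ℤ using (ℤ; _/ℕ_; _%ℕ_)
import Data.Integer.Properties as ℤ
open import Data.Integer.DivMod using (a≡a%ℕn+[a/ℕn]*n; n%ℕd<d)
open import Data.Integer.Divisibility.Signed as Signed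
  using (divides; ∣m∣n⇒∣m-n; ∣m+n∣n⇒∣m; ∣m⇒∣-m; ∣m⇒∣m*n; ∣n⇒∣m*n; ∣⇒∣ᵤ)
open import Data.Integer.Tactic.RingSolver using (solve-∀)
open import Data.Product using (_,_)
open import Relation.Binary.PropositionalEquality using (sym; trans; cong; cong₂; subst; module ≡-Reasoning)

m%n≡1⇒m≡1+[m/n]*n : ∀ m n .{{_ : NonZero n}} → m % n ≡ 1 → m ≡ 1 + (m / n) * n
m%n≡1⇒m≡1+[m/n]*n m n m%n≡1 = trans (ℕ.m≡m%n+[m/n]*n m n) (cong (_+ (m / n) * n) m%n≡1)

[r+q*d]/d≡q : ∀ r q d .{{_ : NonZero d}} → r < d → (r + q * d) / d ≡ q
[r+q*d]/d≡q r q d r<d = begin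
  (r + q * d) / d     ≡⟨ ℕ.+-distrib-/-∣ʳ r (ℕ.divides-refl q) ⟩
  r / d + q * d / d   ≡⟨ cong₂ _+_ (ℕ.m<n⇒m/n≡0 r<d) (ℕ.m*n/n≡m q d) ⟩
  q                   ∎
  where open ≡-Reasoning

+d∣[z%ℕd]-z : ∀ z d .{{_ : NonZero d}} → + d Signed.∣ + (z %ℕ d) - z
+d∣[z%ℕd]-z z d = divides (ℤ.- (z /ℕ d)) (begin
  + (z %ℕ d) - z                                 ≡⟨ cong (+ (z %ℕ d) -_) (a≡a%ℕn+[a/ℕn]*n z d) ⟩
  + (z %ℕ d) - (+ (z %ℕ d) ℤ.+ z /ℕ d ℤ.* + d)   ≡⟨ cancel (+ (z %ℕ d)) (z /ℕ d) (+ d) ⟩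
  ℤ.- (z /ℕ d) ℤ.* + d                           ∎)
  where
  open ≡-Reasoning
  cancel : ∀ r q d → r - (r ℤ.+ q ℤ.* d) ≡ ℤ.- q ℤ.* d
  cancel = solve-∀

+d∣z⇒[z/ℕd]*d≡z : ∀ z d .{{_ : NonZero d}} → + d Signed.∣ z → (z /ℕ d) ℤ.* + d ≡ z
+d∣z⇒[z/ℕd]*d≡z z d d∣z = sym (begin
  z                                 ≡⟨ a≡a%ℕn+[a/ℕn]*n z d ⟩
  + (z %ℕ d) ℤ.+ (z /ℕ d) ℤ.* + d   ≡⟨ cong (λ r → + r ℤ.+ (z /ℕ d) ℤ.* + d) r≡0 ⟩
  + 0 ℤ.+ (z /ℕ d) ℤ.* + d          ≡⟨ ℤ.+-identityˡ _ ⟩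
  (z /ℕ d) ℤ.* + d                  ∎)
  where
  open ≡-Reasoning
  r = z %ℕ d
  d∣r : d ℕ.∣ r
  d∣r = ∣⇒∣ᵤ (∣m+n∣n⇒∣m {m = + r} (+d∣[z%ℕd]-z z d) (∣m⇒∣-m d∣z))
  r≡0 : r ≡ 0
  r≡0 = trans (sym (ℕ.m<n⇒m%n≡m (n%ℕd<d z d))) (ℕ.n∣m⇒m%n≡0 r d d∣r)

d∣x+ct∧d∣ca-1⇒d∣t+xa : ∀ {d t x c a : ℤ} →
  d Signed.∣ x - ℤ.- (c ℤ.* t) → d Signed.∣ c ℤ.* a - 1ℤ → d Signed.∣ t ℤ.+ x ℤ.* a
d∣x+ct∧d∣ca-1⇒d∣t+xa {d} {t} {x} {c} {a} d∣x+ct d∣ca-1 =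
  subst (d Signed.∣_) (sym (regroup t x c a)) (∣m∣n⇒∣m-n (∣m⇒∣m*n a d∣x+ct) (∣n⇒∣m*n t d∣ca-1))
  where
  regroup : ∀ t x c a → t ℤ.+ x ℤ.* a ≡ (x - ℤ.- (c ℤ.* t)) ℤ.* a - t ℤ.* (c ℤ.* a - 1ℤ)
  regroup = solve-∀

multiply-invariant : ∀ {t t′ X a x N P : ℤ} →
  t′ ℤ.* N ≡ t ℤ.+ X ℤ.* a → t ℤ.* P ≡ a ℤ.* x - 1ℤ →
  t′ ℤ.* (N ℤ.* P) ≡ a ℤ.* (x ℤ.+ X ℤ.* P) - 1ℤ
multiply-invariant {t} {t′} {X} {a} {x} {N} {P} t′N≡t+Xa tP≡ax-1 = begin
  t′ ℤ.* (N ℤ.* P)                  ≡⟨ ℤ.*-assoc t′ N P ⟨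
  t′ ℤ.* N ℤ.* P                    ≡⟨ cong (ℤ._* P) t′N≡t+Xa ⟩
  (t ℤ.+ X ℤ.* a) ℤ.* P             ≡⟨ distribute t X a P ⟩
  t ℤ.* P ℤ.+ a ℤ.* X ℤ.* P         ≡⟨ cong (ℤ._+ a ℤ.* X ℤ.* P) tP≡ax-1 ⟩
  a ℤ.* x - 1ℤ ℤ.+ a ℤ.* X ℤ.* P    ≡⟨ collect a x X P ⟩
  a ℤ.* (x ℤ.+ X ℤ.* P) - 1ℤ        ∎
  where
  open ≡-Reasoning
  distribute : ∀ t X a P → (t ℤ.+ X ℤ.* a) ℤ.* P ≡ t ℤ.* P ℤ.+ a ℤ.* X ℤ.* P
  distribute = solve-∀
  collect : ∀ a x X P → a ℤ.* x - 1ℤ ℤ.+ a ℤ.* X ℤ.* P ≡ a ℤ.* (x ℤ.+ X ℤ.* P) - 1ℤ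
  collect = solve-∀

module Inversion (m a c : ℕ) (c<n : c < suc (suc m)) (ca%n≡1 : (c * a) % suc (suc m) ≡ 1) where

  n : ℕ
  n = suc (suc m)

  open InvAlg n a c

  q : ℕ
  q = (c * a) / n

  ca≡1+q*n : c * a ≡ 1 + q * n
  ca≡1+q*n = m%n≡1⇒m≡1+[m/n]*n (c * a) n ca%n≡1

  +n∣ca-1 : + n Signed.∣ + c ℤ.* + a - 1ℤ
  +n∣ca-1 = divides (+ q) (begin
    + c ℤ.* + a - 1ℤ   ≡⟨ cong (_- 1ℤ) (ℤ.pos-* c a) ⟨
    + (c * a) - 1ℤ     ≡⟨ cong (λ k → + k - 1ℤ) ca≡1+q*n ⟩
    + (q * n)          ≡⟨ ℤ.pos-* q n ⟩
    + q ℤ.* + n        ∎)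
    where open ≡-Reasoning

  ca₀%n≡1 : (c * a₀) % n ≡ 1
  ca₀%n≡1 = begin
    (c * (a % n)) % n               ≡⟨ ℕ.%-distribˡ-* c (a % n) n ⟩
    ((c % n) * (a % n % n)) % n     ≡⟨ cong (λ r → ((c % n) * r) % n) (ℕ.m%n%n≡m%n a n) ⟩
    ((c % n) * (a % n)) % n         ≡⟨ ℕ.%-distribˡ-* c a n ⟨
    (c * a) % n                     ≡⟨ ca%n≡1 ⟩
    1                               ∎
    where open ≡-Reasoning

  t : ℕ
  t = (c * a₀) / n

  ca₀≡1+t*n : c * a₀ ≡ 1 + t * n
  ca₀≡1+t*n = m%n≡1⇒m≡1+[m/n]*n (c * a₀) n ca₀%n≡1

  T₀≡t : T 0 ≡ + t
  T₀≡t = begin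
    (+ (c * a₀) - 1ℤ) /ℕ n   ≡⟨ cong (λ k → (+ k - 1ℤ) /ℕ n) ca₀≡1+t*n ⟩
    + (t * n) /ℕ n           ≡⟨ cong +_ (ℕ.m*n/n≡m t n) ⟩
    + t                      ∎
    where open ≡-Reasoning

  -- c a₀ ≤ (n − 1)² = 1 + (n − 2) n
  1+t<n : suc t < n
  1+t<n = s≤s (s≤s (ℕ.*-cancelʳ-≤ t m n (s≤s⁻¹ (begin
    suc (t * n)       ≡⟨ ca₀≡1+t*n ⟨
    c * a₀            ≤⟨ ℕ.*-mono-≤ (s≤s⁻¹ c<n) (s≤s⁻¹ (ℕ.m%n<n a n)) ⟩
    suc m * suc m     ≡⟨ cong suc (ℕ.*-suc m (suc m)) ⟨
    suc (m * n)       ∎))))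
    where open ℕ.≤-Reasoning

  T₁≡q : T 1 ≡ + q
  T₁≡q = begin
    (T 0 ℤ.+ + (c * a)) /ℕ n         ≡⟨ cong₂ (λ u v → (u ℤ.+ + v) /ℕ n) T₀≡t ca≡1+q*n ⟩
    (+ t ℤ.+ + (1 + q * n)) /ℕ n     ≡⟨ cong (_/ℕ n) (ℤ.pos-+ t (1 + q * n)) ⟨
    + ((t + (1 + q * n)) / n)        ≡⟨ cong (λ k → + (k / n)) (ℕ.+-suc t (q * n)) ⟩
    + ((suc t + q * n) / n)          ≡⟨ cong +_ ([r+q*d]/d≡q (suc t) q n 1+t<n) ⟩
    + q                              ∎
    where open ≡-Reasoning

  T[2+i]*n≡T[1+i]+X[1+i]*a : ∀ i → T (2 + i) ℤ.* + n ≡ T (suc i) ℤ.+ + X (suc i) ℤ.* + a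
  T[2+i]*n≡T[1+i]+X[1+i]*a i = begin
    T (2 + i) ℤ.* + n                   ≡⟨ +d∣z⇒[z/ℕd]*d≡z _ n +n∣T+[Xa] ⟩
    T (suc i) ℤ.+ + (X (suc i) * a)     ≡⟨ cong (ℤ._+_ (T (suc i))) (ℤ.pos-* (X (suc i)) a) ⟩
    T (suc i) ℤ.+ + X (suc i) ℤ.* + a   ∎
    where
    open ≡-Reasoning
    +n∣T+Xa : + n Signed.∣ T (suc i) ℤ.+ + X (suc i) ℤ.* + a
    +n∣T+Xa = d∣x+ct∧d∣ca-1⇒d∣t+xa {t = T (suc i)} {x = + X (suc i)} {c = + c}
                (+d∣[z%ℕd]-z (ℤ.- (+ c ℤ.* T (suc i))) n) +n∣ca-1
    +n∣T+[Xa] : + n Signed.∣ T (suc i) ℤ.+ + (X (suc i) * a)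
    +n∣T+[Xa] = subst (+ n Signed.∣_) (cong (ℤ._+_ (T (suc i))) (sym (ℤ.pos-* (X (suc i)) a))) +n∣T+Xa

  T[1+i]*n^[1+i]≡ax[1+i]-1 : ∀ i → T (suc i) ℤ.* + (n ^ suc i) ≡ + (a * x (suc i)) - 1ℤ
  T[1+i]*n^[1+i]≡ax[1+i]-1 zero = begin
    T 1 ℤ.* + (n * 1)          ≡⟨ cong₂ (λ u k → u ℤ.* + k) T₁≡q (ℕ.*-identityʳ n) ⟩
    + q ℤ.* + n                ≡⟨ ℤ.pos-* q n ⟨
    + (1 + q * n) - 1ℤ         ≡⟨ cong (λ k → + k - 1ℤ) ca≡1+q*n ⟨
    + (c * a) - 1ℤ             ≡⟨ cong (λ k → + k - 1ℤ) ca≡a*[0+c*1] ⟩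
    + (a * (0 + c * 1)) - 1ℤ   ∎
    where
    open ≡-Reasoning
    ca≡a*[0+c*1] : c * a ≡ a * (0 + c * 1)
    ca≡a*[0+c*1] = trans (ℕ.*-comm c a) (cong (a *_) (sym (ℕ.*-identityʳ c)))
  T[1+i]*n^[1+i]≡ax[1+i]-1 (suc i) = begin
    T (2 + i) ℤ.* + (n * P)                              ≡⟨ cong (ℤ._*_ (T (2 + i))) (ℤ.pos-* n P) ⟩
    T (2 + i) ℤ.* (+ n ℤ.* + P)                          ≡⟨ multiply-invariant
                                                              {T (suc i)} {T (2 + i)} {+ X (suc i)} {+ a} {+ x (suc i)} {+ n} {+ P}
                                                              (T[2+i]*n≡T[1+i]+X[1+i]*a i) invariant ⟩
    + a ℤ.* (+ x (suc i) ℤ.+ + X (suc i) ℤ.* + P) - 1ℤ   ≡⟨ cong (_- 1ℤ) pos-a[x+XP] ⟨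
    + (a * (x (suc i) + X (suc i) * P)) - 1ℤ             ∎
    where
    open ≡-Reasoning
    P = n ^ suc i
    invariant : T (suc i) ℤ.* + P ≡ + a ℤ.* + x (suc i) - 1ℤ
    invariant = trans (T[1+i]*n^[1+i]≡ax[1+i]-1 i) (cong (_- 1ℤ) (ℤ.pos-* a (x (suc i))))
    pos-a[x+XP] : + (a * (x (suc i) + X (suc i) * P)) ≡ + a ℤ.* (+ x (suc i) ℤ.+ + X (suc i) ℤ.* + P)
    pos-a[x+XP] = trans (ℤ.pos-* a _)
      (cong (ℤ._*_ (+ a)) (trans (ℤ.pos-+ (x (suc i)) _) (cong (ℤ._+_ (+ x (suc i))) (ℤ.pos-* (X (suc i)) P))))

  X<n : ∀ i → X i < n
  X<n zero    = c<n
  X<n (suc i) = n%ℕd<d (ℤ.- (+ c ℤ.* T (suc i))) n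

  x<n^k : ∀ k → x k < n ^ k
  x<n^k zero    = s≤s z≤n
  x<n^k (suc k) = ℕ.<-≤-trans (ℕ.+-monoˡ-< (X k * n ^ k) (x<n^k k)) (ℕ.*-monoˡ-≤ (n ^ k) (X<n k))

mainTheorem1 : (n k a c : ℕ) .{{_ : NonZero n}} → 1 < n → 0 < k →
               0 < a → a < n ^ k → gcd a n ≡ 1 →
               c < n → (c * a) % n ≡ 1 % n →
               (InvAlg.x n a c k < n ^ k) ×
               ((+ (n ^ k)) ∣ (+ (a * InvAlg.x n a c k) - 1ℤ))
mainTheorem1 (suc (suc m)) (suc k) a c (s≤s (s≤s z≤n)) (s≤s z≤n) _ _ _ c<n ca%n≡1 =
  x<n^k (suc k) , ∣⇒∣ᵤ (divides (T (suc k)) (sym (T[1+i]*n^[1+i]≡ax[1+i]-1 k)))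
  where
  open InvAlg (suc (suc m)) a c using (T)
  open Inversion m a c c<n ca%n≡1
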